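{- Let $a$ be a positive integer and let $T_{a,a}=\{C_{i,1}:1\le i\le 2a+1\}\cup\{C_{a+1,j}:2\le j\le a+1\}$, a $T$-shaped polyomino of size $n=3a+1$. Then on the $n\times n$ board, $\mathrm{cp}_{\mathrm{free}}(T_{a,a})=2$.
   Context: A cell $C_{i,j}$ ($i,j$ integers) is the closed unit square in column $i$ and row $j$ of the integer grid. A polyomino is a finite set of cells; its size is its number of cells. For a polyomino $\mathcal P$ of size $n$, the board is $\mathbb B=\{C_{i,j}:1\le i,j\le n\}$. A shift of $\mathcal P$ by an integer pair $(c,d)$ is $\{C_{x+c,y+d}:C_{x,y}\in\mathcal P\}$. Two polyominoes are free equivalent if one is obtained from the other by a rotation of the grid by an integer multiple of $90^\circ$ followed by a shift (reflections are not allowed). A set of polyominoes is a valid arrangement if all lie in $\mathbb B$ and they are pairwise disjoint. A free packing of $\mathcal P$ is a valid arrangement of polyominoes free equivalent to $\mathcal P$ such that adding any further polyomino free equivalent to $\mathcal P$ yields an invalid arrangement. The clumsy free packing number $\mathrm{cp}_{\mathrm{free}}(\mathcal P)$ is the minimum number of polyominoes in a free packing of $\mathcal P$ on the $n\times n$ board, $n=|\mathcal P|$. -}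

module Defs where

open import Data.Nat using (ℕ; zero; suc)
open import Data.Integer using (ℤ; +_; -_; _+_; _≤_)
open import Data.Product using (_×_; _,_; Σ; ∃)
open import Data.List using (List; []; _∷_; map; upTo; _++_; length)
open import Data.List.Membership.Propositional using (_∈_)
open import Data.List.Relation.Unary.All using (All)
open import Data.List.Relation.Unary.AllPairs using (AllPairs)
open import Data.Fin using (Fin; toℕ)
open import Data.Empty using (⊥)
open import Relation.Nullary using (¬_)
open import Function.Bundles using (_⇔_)
open import Relation.Binary.PropositionalEquality using (_≡_)
import Data.Nat

Cell : Set
Cell = ℤ × ℤ

-- A polyomino (finite set of cells) is represented by a list of cells;
-- set-theoretic notions are taken via list membership.
Polyomino : Set
Polyomino = List Cell

-- size = number of cells (used only on duplicate-free lists, e.g. T a a)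
size : Polyomino → ℕ
size = length

rot : Cell → Cell
rot (x , y) = (- y , x)

rotN : ℕ → Cell → Cell
rotN zero    c = c
rotN (suc k) c = rot (rotN k c)

shiftCell : ℤ → ℤ → Cell → Cell
shiftCell c d (x , y) = (x + c , y + d)

transform : Fin 4 → ℤ → ℤ → Polyomino → Polyomino
transform k c d P = map (λ z → shiftCell c d (rotN (toℕ k) z)) P

SameCells : Polyomino → Polyomino → Set
SameCells P Q = ∀ z → (z ∈ P) ⇔ (z ∈ Q)

FreeEquiv : Polyomino → Polyomino → Set
FreeEquiv P Q = Σ (Fin 4) λ k → Σ ℤ λ c → Σ ℤ λ d → SameCells (transform k c d P) Q

InBoard : ℕ → Cell → Set
InBoard n (i , j) = (+ 1 ≤ i) × (i ≤ + n) × (+ 1 ≤ j) × (j ≤ + n)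

LiesIn : ℕ → Polyomino → Set
LiesIn n P = ∀ z → z ∈ P → InBoard n z

Disjoint : Polyomino → Polyomino → Set
Disjoint P Q = ∀ z → z ∈ P → z ∈ Q → ⊥

ValidArrangement : ℕ → List Polyomino → Set
ValidArrangement n A = All (LiesIn n) A × AllPairs Disjoint A

IsFreePacking : Polyomino → List Polyomino → Set
IsFreePacking P A =
  All (FreeEquiv P) A ×
  ValidArrangement (size P) A ×
  (∀ Q → FreeEquiv P Q → ¬ ValidArrangement (size P) (Q ∷ A))

CpFreeIs : Polyomino → ℕ → Set
CpFreeIs P m =
  (Σ (List Polyomino) λ A → IsFreePacking P A × length A ≡ m) ×
  (∀ A → IsFreePacking P A → m Data.Nat.≤ length A)

T : ℕ → Polyomino
T a = map (λ k → (+ suc k , + 1)) (upTo (suc (a Data.Nat.+ a)))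
   ++ map (λ k → (+ suc a , + suc (suc k))) (upTo a)

-- Two upright copies of T, one with its bar on row a over columns 1 .. 2a+1 and one with its bar
-- on row 2a+1 over columns a+1 .. 3a+1, already block the board: a case analysis on the
-- orientation and position of any further copy exhibits a cell it shares with one of them.
-- A single copy never blocks the board.  Either its bounding box leaves a band of a+1 rows or
-- columns free along one side of the board, where a second copy fits, or it sits exactly in the
-- middle band; then the copy pointing the other way on the far side fits, with its stem moved to
-- a different line.  Placements on the board are normalised by their bounding-box corner (s, t),
-- which turns every step into arithmetic on ℕ.

module Submission where

open import Defs
open import Data.Nat using (ℕ; _≤_)
open import Data.Nat using (zero; suc; _+_; _<_; z≤n; s≤s)
open import Data.Nat.Properties
  using (m≤n⇒∃[o]m+o≡n; m+n∸m≡n; m≤m+n; m≤n+m; n≤1+n; ≤-refl; ≤-trans; ≤-reflexive; ≤-pred;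
         <⇒≤; <⇒≱; <-cmp; +-monoˡ-≤; +-monoʳ-≤; +-cancelˡ-≤; +-cancelˡ-≡; +-suc; +-comm;
         +-identityʳ; suc-injective)
open import Data.Nat.Tactic.RingSolver using (solve-∀)
open import Data.Integer as ℤ using (ℤ; +_; -[1+_]; +≤+)
open import Data.Integer.Properties using (⊖-≥; [1+m]⊖[1+n]≡m⊖n; drop‿+≤+)
open import Data.Product using (_×_; _,_; ∃; ∃₂; proj₁; proj₂)
open import Data.Sum using (_⊎_; inj₁; inj₂)
open import Data.List using (List; []; _∷_; map; upTo; _++_; length)
open import Data.List.Properties using (length-++; length-map; length-upTo)
open import Data.List.Membership.Propositional using (_∈_)
open import Data.List.Membership.Propositional.Properties
  using (∈-map⁺; ∈-map⁻; ∈-++⁺ˡ; ∈-++⁺ʳ; ∈-++⁻; ∈-upTo⁺; ∈-upTo⁻)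
open import Data.List.Relation.Unary.All using ([]; _∷_)
open import Data.List.Relation.Unary.AllPairs using ([]; _∷_)
open import Data.Fin using (Fin; toℕ) renaming (zero to fzero; suc to fsuc)
open import Data.Empty using (⊥; ⊥-elim)
open import Relation.Nullary using (¬_)
open import Relation.Binary using (tri<; tri≈; tri>)
open import Function.Bundles using (mk⇔; Equivalence)
open import Function using (id)
open import Relation.Binary.PropositionalEquality using (_≡_; refl; sym; trans; cong; cong₂; subst; subst₂)

-[1+m]+n≡o : ∀ m {n o} → n ≡ suc m + o → -[1+ m ] ℤ.+ + n ≡ + o
-[1+m]+n≡o m {o = o} refl = trans (⊖-≥ (m≤m+n (suc m) o)) (cong +_ (m+n∸m≡n (suc m) o))

1≤1+i⇒i≥0 : ∀ i → + 1 ℤ.≤ + 1 ℤ.+ i → ∃ λ m → i ≡ + m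
1≤1+i⇒i≥0 (+ m) _ = m , refl
1≤1+i⇒i≥0 -[1+ zero ] (+≤+ ())
1≤1+i⇒i≥0 -[1+ suc m ] ()

1≤m⊖1+n⇒m>1+n : ∀ n m → + 1 ℤ.≤ m ℤ.⊖ suc n → ∃ λ k → m ≡ suc n + suc k
1≤m⊖1+n⇒m>1+n n zero ()
1≤m⊖1+n⇒m>1+n zero (suc zero) (+≤+ ())
1≤m⊖1+n⇒m>1+n zero (suc (suc m)) _ = m , refl
1≤m⊖1+n⇒m>1+n (suc n) (suc m) 1≤
  with 1≤m⊖1+n⇒m>1+n n m (subst (+ 1 ℤ.≤_) ([1+m]⊖[1+n]≡m⊖n m (suc n)) 1≤)
... | k , e = k , cong suc e

1≤i-[1+n]⇒i>1+n : ∀ n i → + 1 ℤ.≤ -[1+ n ] ℤ.+ i → ∃ λ k → i ≡ + (suc n + suc k)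
1≤i-[1+n]⇒i>1+n n (+ m) 1≤ with 1≤m⊖1+n⇒m>1+n n m 1≤
... | k , e = k , cong +_ e
1≤i-[1+n]⇒i>1+n n -[1+ m ] ()

-- Placements of T a

barCell : ℕ → Cell
barCell i = (+ suc i , + 1)

stemCell : ℕ → ℕ → Cell
stemCell a j = (+ suc a , + suc (suc j))

bar∈ : ∀ a (h : Cell → Cell) i → i < suc (a + a) → h (barCell i) ∈ map h (T a)
bar∈ a h i i< = ∈-map⁺ h (∈-++⁺ˡ (∈-map⁺ barCell (∈-upTo⁺ i<)))

stem∈ : ∀ a (h : Cell → Cell) j → j < a → h (stemCell a j) ∈ map h (T a)
stem∈ a h j j< =
  ∈-map⁺ h (∈-++⁺ʳ (map barCell (upTo (suc (a + a)))) (∈-map⁺ (stemCell a) (∈-upTo⁺ j<)))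

∈-map-T⁻ : ∀ a (h : Cell → Cell) z → z ∈ map h (T a) →
  (∃ λ i → i < suc (a + a) × z ≡ h (barCell i)) ⊎ (∃ λ j → j < a × z ≡ h (stemCell a j))
∈-map-T⁻ a h z z∈ with ∈-map⁻ h z∈
... | w , w∈ , refl with ∈-++⁻ (map barCell (upTo (suc (a + a)))) w∈
... | inj₁ w∈bar with ∈-map⁻ barCell w∈bar
...   | i , i∈ , refl = inj₁ (i , ∈-upTo⁻ i∈ , refl)
∈-map-T⁻ a h z z∈ | w , w∈ , refl | inj₂ w∈stem with ∈-map⁻ (stemCell a) w∈stem
...   | j , j∈ , refl = inj₂ (j , ∈-upTo⁻ j∈ , refl)

-- An orientation is named by the direction in which the stem points.
pattern up    = fzero
pattern left  = fsuc fzero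
pattern down  = fsuc (fsuc fzero)
pattern right = fsuc (fsuc (fsuc fzero))

-- The shifts are chosen so that placement a k s t has the lower left corner of its bounding box
-- at (s + 1 , t + 1).
xShift : ℕ → Fin 4 → ℕ → ℤ
xShift a up    s = + s
xShift a left  s = + (suc a + suc s)
xShift a down  s = + (suc (a + a) + suc s)
xShift a right s = + s

yShift : ℕ → Fin 4 → ℕ → ℤ
yShift a up    t = + t
yShift a left  t = + t
yShift a down  t = + (suc a + suc t)
yShift a right t = + (suc (a + a) + suc t)

move : Fin 4 → ℤ → ℤ → Cell → Cell
move k c d z = shiftCell c d (rotN (toℕ k) z)

place : ℕ → Fin 4 → ℕ → ℕ → Cell → Cell
place a k s t = move k (xShift a k s) (yShift a k t)

placement : ℕ → Fin 4 → ℕ → ℕ → Polyomino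
placement a k s t = transform k (xShift a k s) (yShift a k t) (T a)

Row : ℕ → ℕ → ℕ → ℕ → ℕ → Set
Row y x₁ x₂ X Y = Y ≡ y × x₁ ≤ X × X ≤ x₂

Column : ℕ → ℕ → ℕ → ℕ → ℕ → Set
Column x y₁ y₂ X Y = X ≡ x × y₁ ≤ Y × Y ≤ y₂

Bar : ℕ → Fin 4 → ℕ → ℕ → ℕ → ℕ → Set
Bar a up    s t = Row (suc t) (suc s) (suc (a + a) + s)
Bar a left  s t = Column (a + suc s) (suc t) (suc (a + a) + t)
Bar a down  s t = Row (a + suc t) (suc s) (suc (a + a) + s)
Bar a right s t = Column (suc s) (suc t) (suc (a + a) + t)

Stem : ℕ → Fin 4 → ℕ → ℕ → ℕ → ℕ → Set
Stem a up    s t = Column (suc a + s) (2 + t) (suc a + t)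
Stem a left  s t = Row (suc a + t) (suc s) (a + s)
Stem a down  s t = Column (a + suc s) (suc t) (a + t)
Stem a right s t = Row (a + suc t) (2 + s) (suc a + s)

Covers : ℕ → Fin 4 → ℕ → ℕ → ℕ → ℕ → Set
Covers a k s t X Y = Bar a k s t X Y ⊎ Stem a k s t X Y

bar-position : ∀ a k s t i → i < suc (a + a) →
  ∃₂ λ X Y → place a k s t (barCell i) ≡ (+ X , + Y) × Bar a k s t X Y
bar-position a up s t i i< = suc i + s , suc t , refl , refl , s≤s (m≤n+m s i) , +-monoˡ-≤ s i<
bar-position a left s t i i< = a + suc s , suc i + t , refl , refl , s≤s (m≤n+m t i) , +-monoˡ-≤ t i<
bar-position a down s t i (s≤s i≤) with m≤n⇒∃[o]m+o≡n i≤
... | w , e = w + suc s , a + suc t ,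
  cong₂ _,_ (-[1+m]+n≡o i (trans (cong (λ q → suc q + suc s) (sym e)) (eq i w s))) refl ,
  refl , m≤n+m (suc s) w , subst (w + suc s ≤_) (trans (eq′ i w s) (cong (λ q → suc q + s) e)) (m≤m+n _ i)
  where
  eq : ∀ i w s → suc (i + w) + suc s ≡ suc i + (w + suc s)
  eq = solve-∀
  eq′ : ∀ i w s → w + suc s + i ≡ suc (i + w) + s
  eq′ = solve-∀
bar-position a right s t i (s≤s i≤) with m≤n⇒∃[o]m+o≡n i≤
... | w , e = suc s , w + suc t ,
  cong₂ _,_ refl (-[1+m]+n≡o i (trans (cong (λ q → suc q + suc t) (sym e)) (eq i w t))) ,
  refl , m≤n+m (suc t) w , subst (w + suc t ≤_) (trans (eq′ i w t) (cong (λ q → suc q + t) e)) (m≤m+n _ i)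
  where
  eq : ∀ i w t → suc (i + w) + suc t ≡ suc i + (w + suc t)
  eq = solve-∀
  eq′ : ∀ i w t → w + suc t + i ≡ suc (i + w) + t
  eq′ = solve-∀

stem-position : ∀ a k s t j → j < a →
  ∃₂ λ X Y → place a k s t (stemCell a j) ≡ (+ X , + Y) × Stem a k s t X Y
stem-position a up s t j j< =
  suc a + s , suc (suc j) + t , refl , refl , s≤s (s≤s (m≤n+m t j)) , +-monoˡ-≤ t (s≤s j<)
stem-position a left s t j j< with m≤n⇒∃[o]m+o≡n j<
... | w , refl = w + suc s , suc (suc j + w) + t ,
  cong₂ _,_ (-[1+m]+n≡o (suc j) (eq j w s)) refl ,
  refl , m≤n+m (suc s) w , subst (w + suc s ≤_) (eq′ j w s) (m≤m+n _ j)
  where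
  eq : ∀ j w s → suc (suc j + w) + suc s ≡ suc (suc j) + (w + suc s)
  eq = solve-∀
  eq′ : ∀ j w s → w + suc s + j ≡ suc j + w + s
  eq′ = solve-∀
stem-position a down s t j j< with m≤n⇒∃[o]m+o≡n j<
... | w , refl = (suc j + w) + suc s , w + suc t ,
  cong₂ _,_ (-[1+m]+n≡o (suc j + w) (eq j w s)) (-[1+m]+n≡o (suc j) (eq′ j w t)) ,
  refl , m≤n+m (suc t) w , subst (w + suc t ≤_) (eq″ j w t) (m≤m+n _ j)
  where
  eq : ∀ j w s → suc ((suc j + w) + (suc j + w)) + suc s ≡ suc (suc j + w) + ((suc j + w) + suc s)
  eq = solve-∀
  eq′ : ∀ j w t → suc (suc j + w) + suc t ≡ suc (suc j) + (w + suc t)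
  eq′ = solve-∀
  eq″ : ∀ j w t → w + suc t + j ≡ suc j + w + t
  eq″ = solve-∀
stem-position a right s t j j< =
  suc (suc j) + s , a + suc t , cong₂ _,_ refl (-[1+m]+n≡o a (eq a t)) ,
  refl , s≤s (s≤s (m≤n+m s j)) , +-monoˡ-≤ s (s≤s j<)
  where
  eq : ∀ a t → suc (a + a) + suc t ≡ suc a + (a + suc t)
  eq = solve-∀

∈placement⇒covers : ∀ a k s t z → z ∈ placement a k s t →
  ∃₂ λ X Y → z ≡ (+ X , + Y) × Covers a k s t X Y
∈placement⇒covers a k s t z z∈ with ∈-map-T⁻ a (place a k s t) z z∈
... | inj₁ (i , i< , refl) with bar-position a k s t i i<
...   | X , Y , e , bar = X , Y , e , inj₁ bar
∈placement⇒covers a k s t z z∈ | inj₂ (j , j< , refl) with stem-position a k s t j j<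
...   | X , Y , e , stem = X , Y , e , inj₂ stem

s+u<m+s⇒u<m : ∀ s u m → suc s + u ≤ m + s → suc u ≤ m
s+u<m+s⇒u<m s u m p = +-cancelˡ-≤ s (suc u) m (subst₂ _≤_ (sym (+-suc s u)) (+-comm m s) p)

1+s+u<1+m+s⇒u<m : ∀ s u m → suc (suc s) + u ≤ suc m + s → suc u ≤ m
1+s+u<1+m+s⇒u<m s u m p =
  ≤-pred (s+u<m+s⇒u<m s (suc u) (suc m) (subst (_≤ suc m + s) (cong suc (sym (+-suc s u))) p))

barCell∈placement : ∀ a k s t i → i < suc (a + a) →
  ∀ {z} → place a k s t (barCell i) ≡ z → z ∈ placement a k s t
barCell∈placement a k s t i i< refl = bar∈ a (place a k s t) i i<

stemCell∈placement : ∀ a k s t j → j < a →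
  ∀ {z} → place a k s t (stemCell a j) ≡ z → z ∈ placement a k s t
stemCell∈placement a k s t j j< refl = stem∈ a (place a k s t) j j<

bar⇒∈placement : ∀ a k s t X Y → Bar a k s t X Y → (+ X , + Y) ∈ placement a k s t
bar⇒∈placement a up s t X Y (refl , p , q) with m≤n⇒∃[o]m+o≡n p
... | u , refl =
  barCell∈placement a up s t u (s+u<m+s⇒u<m s u _ q) (cong₂ _,_ (cong (λ m → + suc m) (+-comm u s)) refl)
bar⇒∈placement a left s t X Y (refl , p , q) with m≤n⇒∃[o]m+o≡n p
... | u , refl =
  barCell∈placement a left s t u (s+u<m+s⇒u<m t u _ q) (cong₂ _,_ refl (cong (λ m → + suc m) (+-comm u t)))
bar⇒∈placement a down s t X Y (refl , p , q) with m≤n⇒∃[o]m+o≡n p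
... | u , refl with m≤n⇒∃[o]m+o≡n (≤-pred (s+u<m+s⇒u<m s u _ q))
...   | i , e = barCell∈placement a down s t i (s≤s (subst (i ≤_) (trans (+-comm i u) e) (m≤m+n i u)))
  (cong₂ _,_ (-[1+m]+n≡o i (trans (cong (λ r → suc r + suc s) (sym e)) (eq u i s))) refl)
  where
  eq : ∀ u i s → suc (u + i) + suc s ≡ suc i + (suc s + u)
  eq = solve-∀
bar⇒∈placement a right s t X Y (refl , p , q) with m≤n⇒∃[o]m+o≡n p
... | u , refl with m≤n⇒∃[o]m+o≡n (≤-pred (s+u<m+s⇒u<m t u _ q))
...   | i , e = barCell∈placement a right s t i (s≤s (subst (i ≤_) (trans (+-comm i u) e) (m≤m+n i u)))
  (cong₂ _,_ refl (-[1+m]+n≡o i (trans (cong (λ r → suc r + suc t) (sym e)) (eq u i t))))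
  where
  eq : ∀ u i t → suc (u + i) + suc t ≡ suc i + (suc t + u)
  eq = solve-∀

stem⇒∈placement : ∀ a k s t X Y → Stem a k s t X Y → (+ X , + Y) ∈ placement a k s t
stem⇒∈placement a up s t X Y (refl , p , q) with m≤n⇒∃[o]m+o≡n p
... | u , refl =
  stemCell∈placement a up s t u (1+s+u<1+m+s⇒u<m t u a q)
    (cong₂ _,_ refl (cong (λ m → + suc (suc m)) (+-comm u t)))
stem⇒∈placement a left s t X Y (refl , p , q) with m≤n⇒∃[o]m+o≡n p
... | u , refl with m≤n⇒∃[o]m+o≡n (s+u<m+s⇒u<m s u a q)
...   | j , refl = stemCell∈placement (suc u + j) left s t j (s≤s (m≤n+m j u))
  (cong₂ _,_ (-[1+m]+n≡o (suc j) (eq u j s)) refl)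
  where
  eq : ∀ u j s → suc (suc u + j) + suc s ≡ suc (suc j) + (suc s + u)
  eq = solve-∀
stem⇒∈placement a down s t X Y (refl , p , q) with m≤n⇒∃[o]m+o≡n p
... | u , refl with m≤n⇒∃[o]m+o≡n (s+u<m+s⇒u<m t u a q)
...   | j , refl = stemCell∈placement (suc u + j) down s t j (s≤s (m≤n+m j u))
  (cong₂ _,_ (-[1+m]+n≡o (suc u + j) (eq′ (suc u + j) s)) (-[1+m]+n≡o (suc j) (eq u j t)))
  where
  eq : ∀ u j t → suc (suc u + j) + suc t ≡ suc (suc j) + (suc t + u)
  eq = solve-∀
  eq′ : ∀ a s → suc (a + a) + suc s ≡ suc a + (a + suc s)
  eq′ = solve-∀
stem⇒∈placement a right s t X Y (refl , p , q) with m≤n⇒∃[o]m+o≡n p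
... | u , refl = stemCell∈placement a right s t u (1+s+u<1+m+s⇒u<m s u a q)
  (cong₂ _,_ (cong (λ m → + suc (suc m)) (+-comm u s)) (-[1+m]+n≡o a (eq a t)))
  where
  eq : ∀ a t → suc (a + a) + suc t ≡ suc a + (a + suc t)
  eq = solve-∀

covers⇒∈placement : ∀ a k s t X Y → Covers a k s t X Y → (+ X , + Y) ∈ placement a k s t
covers⇒∈placement a k s t X Y (inj₁ bar)  = bar⇒∈placement a k s t X Y bar
covers⇒∈placement a k s t X Y (inj₂ stem) = stem⇒∈placement a k s t X Y stem

width : ℕ → Fin 4 → ℕ
width a up    = suc (a + a)
width a left  = suc a
width a down  = suc (a + a)
width a right = suc a

height : ℕ → Fin 4 → ℕ
height a up    = suc a
height a left  = suc (a + a)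
height a down  = suc a
height a right = suc (a + a)

record InBox (a : ℕ) (k : Fin 4) (s t X Y : ℕ) : Set where
  constructor inBox
  field
    s<X : suc s ≤ X
    X≤  : X ≤ width a k + s
    t<Y : suc t ≤ Y
    Y≤  : Y ≤ height a k + t

covers⇒inBox : ∀ a k s t X Y → Covers a k s t X Y → InBox a k s t X Y
covers⇒inBox a up s t X Y (inj₁ (refl , p , q)) = inBox p q ≤-refl (s≤s (m≤n+m t a))
covers⇒inBox a up s t X Y (inj₂ (refl , p , q)) =
  inBox (s≤s (m≤n+m s a)) (+-monoˡ-≤ s (s≤s (m≤m+n a a))) (≤-trans (n≤1+n _) p) q
covers⇒inBox a left s t X Y (inj₁ (refl , p , q)) = inBox (m≤n+m (suc s) a) (≤-reflexive (+-suc a s)) p q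
covers⇒inBox a left s t X Y (inj₂ (refl , p , q)) =
  inBox p (≤-trans q (n≤1+n _)) (s≤s (m≤n+m t a)) (+-monoˡ-≤ t (s≤s (m≤m+n a a)))
covers⇒inBox a down s t X Y (inj₁ (refl , p , q)) = inBox p q (m≤n+m (suc t) a) (≤-reflexive (+-suc a t))
covers⇒inBox a down s t X Y (inj₂ (refl , p , q)) =
  inBox (m≤n+m (suc s) a) (≤-trans (≤-reflexive (+-suc a s)) (+-monoˡ-≤ s (s≤s (m≤m+n a a))))
        p (≤-trans q (n≤1+n _))
covers⇒inBox a right s t X Y (inj₁ (refl , p , q)) = inBox ≤-refl (s≤s (m≤n+m s a)) p q
covers⇒inBox a right s t X Y (inj₂ (refl , p , q)) =
  inBox (≤-trans (n≤1+n _) p) q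
        (m≤n+m (suc t) a) (≤-trans (≤-reflexive (+-suc a t)) (+-monoˡ-≤ t (s≤s (m≤m+n a a))))

boardSide : ℕ → ℕ
boardSide a = suc (a + a) + a

size-T : ∀ a → size (T a) ≡ boardSide a
size-T a = trans (length-++ (map barCell (upTo (suc (a + a)))))
  (cong₂ _+_ (trans (length-map _ (upTo (suc (a + a)))) (length-upTo (suc (a + a))))
             (trans (length-map _ (upTo a)) (length-upTo a)))

boardSide-long : ∀ a → suc a + (a + a) ≡ boardSide a
boardSide-long a = cong suc (+-comm a (a + a))

≤a⇒1+2a+≤boardSide : ∀ a {s} → s ≤ a → suc (a + a) + s ≤ boardSide a
≤a⇒1+2a+≤boardSide a = +-monoʳ-≤ (suc (a + a))

1+2a+≤boardSide⇒≤a : ∀ a {s} → suc (a + a) + s ≤ boardSide a → s ≤ a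
1+2a+≤boardSide⇒≤a a {s} = +-cancelˡ-≤ (suc (a + a)) s a

≤2a⇒1+a+≤boardSide : ∀ a {s} → s ≤ a + a → suc a + s ≤ boardSide a
≤2a⇒1+a+≤boardSide a s≤ = ≤-trans (+-monoʳ-≤ (suc a) s≤) (≤-reflexive (boardSide-long a))

1+a+≤boardSide⇒≤2a : ∀ a {s} → suc a + s ≤ boardSide a → s ≤ a + a
1+a+≤boardSide⇒≤2a a {s} p =
  +-cancelˡ-≤ (suc a) s (a + a) (≤-trans p (≤-reflexive (sym (boardSide-long a))))

Fits : ℕ → Fin 4 → ℕ → ℕ → Set
Fits a up    s t = s ≤ a × t ≤ a + a
Fits a left  s t = s ≤ a + a × t ≤ a
Fits a down  s t = s ≤ a × t ≤ a + a
Fits a right s t = s ≤ a + a × t ≤ a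

fits⇒corner≤boardSide : ∀ a k s t → Fits a k s t →
  width a k + s ≤ boardSide a × height a k + t ≤ boardSide a
fits⇒corner≤boardSide a up    s t (s≤ , t≤) = ≤a⇒1+2a+≤boardSide a s≤ , ≤2a⇒1+a+≤boardSide a t≤
fits⇒corner≤boardSide a left  s t (s≤ , t≤) = ≤2a⇒1+a+≤boardSide a s≤ , ≤a⇒1+2a+≤boardSide a t≤
fits⇒corner≤boardSide a down  s t (s≤ , t≤) = ≤a⇒1+2a+≤boardSide a s≤ , ≤2a⇒1+a+≤boardSide a t≤
fits⇒corner≤boardSide a right s t (s≤ , t≤) = ≤2a⇒1+a+≤boardSide a s≤ , ≤a⇒1+2a+≤boardSide a t≤

fits⇒liesIn : ∀ a k s t → Fits a k s t → LiesIn (boardSide a) (placement a k s t)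
fits⇒liesIn a k s t fits z z∈ with ∈placement⇒covers a k s t z z∈
... | X , Y , refl , covers with covers⇒inBox a k s t X Y covers | fits⇒corner≤boardSide a k s t fits
...   | inBox s<X X≤ t<Y Y≤ | right≤ , top≤ =
  +≤+ (≤-trans (s≤s z≤n) s<X) , +≤+ (≤-trans X≤ right≤) ,
  +≤+ (≤-trans (s≤s z≤n) t<Y) , +≤+ (≤-trans Y≤ top≤)

liesIn⇒1≤x : ∀ {n P x y} → LiesIn n P → (x , y) ∈ P → + 1 ℤ.≤ x
liesIn⇒1≤x inP xy∈ = proj₁ (inP _ xy∈)

liesIn⇒1≤y : ∀ {n P x y} → LiesIn n P → (x , y) ∈ P → + 1 ℤ.≤ y
liesIn⇒1≤y inP xy∈ = proj₁ (proj₂ (proj₂ (inP _ xy∈)))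

liesIn⇒x≤n : ∀ {n P X Y} → LiesIn n P → (+ X , + Y) ∈ P → X ≤ n
liesIn⇒x≤n inP XY∈ = drop‿+≤+ (proj₁ (proj₂ (inP _ XY∈)))

liesIn⇒y≤n : ∀ {n P X Y} → LiesIn n P → (+ X , + Y) ∈ P → Y ≤ n
liesIn⇒y≤n inP XY∈ = drop‿+≤+ (proj₂ (proj₂ (proj₂ (inP _ XY∈))))

sameCells-liesIn : ∀ {n P Q} → SameCells P Q → LiesIn n Q → LiesIn n P
sameCells-liesIn same inQ z z∈ = inQ z (Equivalence.to (same z) z∈)

placement-freeEquiv : ∀ a k s t → FreeEquiv (T a) (placement a k s t)
placement-freeEquiv a k s t = k , xShift a k s , yShift a k t , λ z → mk⇔ id id

liesIn-size⇒boardSide : ∀ a {Q} → LiesIn (size (T a)) Q → LiesIn (boardSide a) Q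
liesIn-size⇒boardSide a {Q} = subst (λ n → LiesIn n Q) (size-T a)

fits⇒liesIn-size : ∀ a k s t → Fits a k s t → LiesIn (size (T a)) (placement a k s t)
fits⇒liesIn-size a k s t fits =
  subst (λ n → LiesIn n (placement a k s t)) (sym (size-T a)) (fits⇒liesIn a k s t fits)

disjoint-sameCells : ∀ {P Q R} → SameCells P Q → Disjoint R P → Disjoint R Q
disjoint-sameCells same R#P z z∈R z∈Q = R#P z z∈R (Equivalence.from (same z) z∈Q)

sharedCell⇒¬disjoint : ∀ a k s t k′ s′ t′ {Q} X Y → SameCells (placement a k s t) Q →
  Covers a k s t X Y → Covers a k′ s′ t′ X Y → ¬ Disjoint Q (placement a k′ s′ t′)
sharedCell⇒¬disjoint a k s t k′ s′ t′ X Y same c c′ Q#P =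
  Q#P _ (Equivalence.to (same _) (covers⇒∈placement a k s t X Y c))
        (covers⇒∈placement a k′ s′ t′ X Y c′)

placements-disjoint : ∀ a k s t k′ s′ t′ → (∀ X Y → Covers a k s t X Y → Covers a k′ s′ t′ X Y → ⊥) →
  Disjoint (placement a k s t) (placement a k′ s′ t′)
placements-disjoint a k s t k′ s′ t′ apart z z∈ z∈′
  with ∈placement⇒covers a k s t z z∈ | ∈placement⇒covers a k′ s′ t′ z z∈′
... | X , Y , refl , covers | _ , _ , refl , covers′ = apart X Y covers covers′

-- No single copy is a free packing

Avoidable : ℕ → Fin 4 → ℕ → ℕ → Set
Avoidable a k s t = ∃ λ k′ → ∃₂ λ s′ t′ → Fits a k′ s′ t′ ×
  (∀ X Y → Covers a k′ s′ t′ X Y → Covers a k s t X Y → ⊥)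

separated : ∀ {Y u v} → Y ≤ u → v ≤ Y → u < v → ⊥
separated Y≤u v≤Y u<v = <⇒≱ u<v (≤-trans v≤Y Y≤u)

avoidable-above : ∀ a k s t → a < t → Avoidable a k s t
avoidable-above a k s t a<t = up , 0 , 0 , (z≤n , z≤n) ,
  λ X Y c′ c → separated (InBox.Y≤ (covers⇒inBox a up 0 0 X Y c′))
                           (InBox.t<Y (covers⇒inBox a k s t X Y c))
    (s≤s (subst (_≤ t) (sym (+-identityʳ (suc a))) a<t))

avoidable-rightOf : ∀ a k s t → a < s → Avoidable a k s t
avoidable-rightOf a k s t a<s = left , 0 , 0 , (z≤n , z≤n) ,
  λ X Y c′ c → separated (InBox.X≤ (covers⇒inBox a left 0 0 X Y c′))
                           (InBox.s<X (covers⇒inBox a k s t X Y c))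
    (s≤s (subst (_≤ s) (sym (+-identityʳ (suc a))) a<s))

avoidable-below : ∀ a k s t → height a k ≡ suc a → t < a → Avoidable a k s t
avoidable-below a k s t h≡ t<a = up , 0 , a + a , (z≤n , ≤-refl) ,
  λ X Y c′ c → separated (InBox.Y≤ (covers⇒inBox a k s t X Y c))
                           (InBox.t<Y (covers⇒inBox a up 0 (a + a) X Y c′))
    (s≤s (subst₂ _≤_ (trans (+-suc a t) (cong (_+ t) (sym h≡))) refl (+-monoʳ-≤ a t<a)))

avoidable-leftOf : ∀ a k s t → width a k ≡ suc a → s < a → Avoidable a k s t
avoidable-leftOf a k s t w≡ s<a = left , a + a , 0 , (≤-refl , z≤n) ,
  λ X Y c′ c → separated (InBox.X≤ (covers⇒inBox a k s t X Y c))
                           (InBox.s<X (covers⇒inBox a left (a + a) 0 X Y c′))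
    (s≤s (subst₂ _≤_ (trans (+-suc a s) (cong (_+ s) (sym w≡))) refl (+-monoʳ-≤ a s<a)))

otherThan : ℕ → ℕ
otherThan zero    = 1
otherThan (suc _) = 0

otherThan≢ : ∀ s → otherThan s ≡ s → ⊥
otherThan≢ zero    ()
otherThan≢ (suc s) ()

otherThan≤1+ : ∀ s n → otherThan s ≤ suc n
otherThan≤1+ zero    n = s≤s z≤n
otherThan≤1+ (suc s) n = z≤n

1+a+s≡a+1+s′⇒s≡s′ : ∀ a {s s′} → suc a + s ≡ a + suc s′ → s ≡ s′
1+a+s≡a+1+s′⇒s≡s′ a {s} {s′} e = +-cancelˡ-≡ a s s′ (suc-injective (trans e (+-suc a s′)))

module _ (b : ℕ) where

  private
    a : ℕ
    a = suc b

  liesIn⇒canonical : ∀ n k c d → LiesIn n (transform k c d (T a)) →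
    ∃₂ λ s t → c ≡ xShift a k s × d ≡ yShift a k t
  liesIn⇒canonical n up c d inP
    with 1≤1+i⇒i≥0 c (liesIn⇒1≤x inP (bar∈ a (move up c d) 0 (s≤s z≤n)))
       | 1≤1+i⇒i≥0 d (liesIn⇒1≤y inP (bar∈ a (move up c d) 0 (s≤s z≤n)))
  ... | s , refl | t , refl = s , t , refl , refl
  liesIn⇒canonical n left c d inP
    with 1≤i-[1+n]⇒i>1+n a c (liesIn⇒1≤x inP (stem∈ a (move left c d) b ≤-refl))
       | 1≤1+i⇒i≥0 d (liesIn⇒1≤y inP (bar∈ a (move left c d) 0 (s≤s z≤n)))
  ... | s , refl | t , refl = s , t , refl , refl
  liesIn⇒canonical n down c d inP
    with 1≤i-[1+n]⇒i>1+n (a + a) c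
           (liesIn⇒1≤x inP (bar∈ a (move down c d) (a + a) ≤-refl))
       | 1≤i-[1+n]⇒i>1+n a d (liesIn⇒1≤y inP (stem∈ a (move down c d) b ≤-refl))
  ... | s , refl | t , refl = s , t , refl , refl
  liesIn⇒canonical n right c d inP
    with 1≤1+i⇒i≥0 c (liesIn⇒1≤x inP (bar∈ a (move right c d) 0 (s≤s z≤n)))
       | 1≤i-[1+n]⇒i>1+n (a + a) d
           (liesIn⇒1≤y inP (bar∈ a (move right c d) (a + a) ≤-refl))
  ... | s , refl | t , refl = s , t , refl , refl

  liesIn⇒fits : ∀ k s t → LiesIn (boardSide a) (placement a k s t) → Fits a k s t
  liesIn⇒fits up s t inP =
    1+2a+≤boardSide⇒≤a a (liesIn⇒x≤n inP barEnd∈) , 1+a+≤boardSide⇒≤2a a (liesIn⇒y≤n inP stemTip∈)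
    where
    barEnd∈ : (+ (suc (a + a) + s) , + suc t) ∈ placement a up s t
    barEnd∈ = covers⇒∈placement a up s t _ _ (inj₁ (refl , s≤s (m≤n+m s (a + a)) , ≤-refl))
    stemTip∈ : (+ (suc a + s) , + (suc a + t)) ∈ placement a up s t
    stemTip∈ = covers⇒∈placement a up s t _ _ (inj₂ (refl , s≤s (s≤s (m≤n+m t b)) , ≤-refl))
  liesIn⇒fits left s t inP =
    1+a+≤boardSide⇒≤2a a (subst (_≤ boardSide a) (+-suc a s) (liesIn⇒x≤n inP barEnd∈)) ,
    1+2a+≤boardSide⇒≤a a (liesIn⇒y≤n inP barEnd∈)
    where
    barEnd∈ : (+ (a + suc s) , + (suc (a + a) + t)) ∈ placement a left s t
    barEnd∈ = covers⇒∈placement a left s t _ _ (inj₁ (refl , s≤s (m≤n+m t (a + a)) , ≤-refl))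
  liesIn⇒fits down s t inP =
    1+2a+≤boardSide⇒≤a a (liesIn⇒x≤n inP barEnd∈) ,
    1+a+≤boardSide⇒≤2a a (subst (_≤ boardSide a) (+-suc a t) (liesIn⇒y≤n inP barEnd∈))
    where
    barEnd∈ : (+ (suc (a + a) + s) , + (a + suc t)) ∈ placement a down s t
    barEnd∈ = covers⇒∈placement a down s t _ _ (inj₁ (refl , s≤s (m≤n+m s (a + a)) , ≤-refl))
  liesIn⇒fits right s t inP =
    1+a+≤boardSide⇒≤2a a (liesIn⇒x≤n inP stemTip∈) , 1+2a+≤boardSide⇒≤a a (liesIn⇒y≤n inP barEnd∈)
    where
    barEnd∈ : (+ suc s , + (suc (a + a) + t)) ∈ placement a right s t
    barEnd∈ = covers⇒∈placement a right s t _ _ (inj₁ (refl , s≤s (m≤n+m t (a + a)) , ≤-refl))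
    stemTip∈ : (+ (suc a + s) , + (a + suc t)) ∈ placement a right s t
    stemTip∈ = covers⇒∈placement a right s t _ _ (inj₂ (refl , s≤s (s≤s (m≤n+m s b)) , ≤-refl))

  inBoard-freeEquiv⇒placement : ∀ Q → FreeEquiv (T a) Q → LiesIn (boardSide a) Q →
    ∃ λ k → ∃₂ λ s t → Fits a k s t × SameCells (placement a k s t) Q
  inBoard-freeEquiv⇒placement Q (k , c , d , same) inQ
    with liesIn⇒canonical (boardSide a) k c d (sameCells-liesIn same inQ)
  ... | s , t , refl , refl = k , s , t , liesIn⇒fits k s t (sameCells-liesIn same inQ) , same

  -- Every copy meets the two-copy packing

  lowerT : Polyomino
  lowerT = placement a up 0 b

  upperT : Polyomino
  upperT = placement a up a (a + a)

  MeetsPacking : Fin 4 → ℕ → ℕ → Set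
  MeetsPacking k s t = ∃₂ λ X Y → Covers a k s t X Y ×
    (Covers a up 0 b X Y ⊎ Covers a up a (a + a) X Y)

  meetsPacking-up : ∀ s t → s ≤ a → t ≤ a + a → MeetsPacking up s t
  meetsPacking-up s t s≤ t≤ with <-cmp t b
  ... | tri≈ _ refl _ = suc a + s , a ,
         inj₁ (refl , s≤s (m≤n+m s a) , +-monoˡ-≤ s (s≤s (m≤m+n a a))) ,
         inj₁ (inj₁ (refl , s≤s z≤n ,
           ≤-trans (+-monoʳ-≤ (suc a) s≤) (≤-reflexive (sym (+-identityʳ _)))))
  ... | tri< t<b _ _ = suc a + s , a ,
         inj₂ (refl , s≤s t<b , s≤s (≤-trans (n≤1+n b) (m≤m+n a t))) ,
         inj₁ (inj₁ (refl , s≤s z≤n ,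
           ≤-trans (+-monoʳ-≤ (suc a) s≤) (≤-reflexive (sym (+-identityʳ _)))))
  ... | tri> _ _ b<t with <-cmp t (a + a)
  ...   | tri< t<2a _ _ = suc a , suc t ,
         inj₁ (refl , s≤s s≤ , s≤s (≤-trans (m≤m+n a a) (m≤m+n (a + a) s))) ,
         inj₁ (inj₂ (sym (+-identityʳ (suc a)) , s≤s b<t ,
           s≤s (subst₂ _≤_ refl (+-suc b b) (≤-pred t<2a))))
  ...   | tri≈ _ refl _ = suc a + s , suc (a + a) ,
         inj₁ (refl , s≤s (m≤n+m s a) , +-monoˡ-≤ s (s≤s (m≤m+n a a))) ,
         inj₂ (inj₁ (refl , s≤s (m≤m+n a s) , ≤-trans (+-monoʳ-≤ (suc a) s≤) (s≤s (m≤m+n (a + a) a))))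
  ...   | tri> _ _ 2a<t = ⊥-elim (<⇒≱ 2a<t t≤)

  meetsPacking-left : ∀ s t → s ≤ a + a → t ≤ a → MeetsPacking left s t
  meetsPacking-left s t s≤ t≤ = a + suc s , suc (a + a) ,
     inj₁ (refl , s≤s (≤-trans t≤ (m≤m+n a a)) , m≤m+n _ t) ,
     inj₂ (inj₁ (refl , subst₂ _≤_ refl (sym (+-suc a s)) (s≤s (m≤m+n a s)) ,
        subst₂ _≤_ (sym (+-suc a s)) refl
          (s≤s (≤-trans (+-monoʳ-≤ a s≤) (≤-reflexive (+-comm a (a + a)))))))

  meetsPacking-down : ∀ s t → s ≤ a → t ≤ a + a → MeetsPacking down s t
  meetsPacking-down s t s≤ t≤ with <-cmp t a
  ... | tri< t<a _ _ = suc a , a + suc t ,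
     inj₁ (refl , s≤s s≤ , s≤s (≤-trans (m≤m+n a a) (m≤m+n _ s))) ,
     inj₁ (inj₂ (sym (+-identityʳ (suc a)) , subst₂ _≤_ refl (sym (+-suc a t)) (s≤s (m≤m+n a t)) ,
        subst₂ _≤_ (sym (+-suc a t)) refl (s≤s (+-monoʳ-≤ a (≤-pred t<a)))))
  ... | tri≈ _ refl _ = suc a + s , a + suc a ,
     inj₁ (refl , s≤s (m≤n+m s a) , +-monoˡ-≤ s (s≤s (m≤m+n a a))) ,
     inj₂ (inj₁ (+-suc a a , s≤s (m≤m+n a s) , ≤-trans (+-monoʳ-≤ (suc a) s≤) (s≤s (m≤m+n (a + a) a))))
  ... | tri> _ _ a<t = suc (a + a) , a + suc t ,
     inj₁ (refl , s≤s (≤-trans s≤ (m≤m+n a a)) , m≤m+n _ s) ,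
     inj₂ (inj₂ (refl ,
        subst₂ _≤_ refl (sym (+-suc a t)) (s≤s (subst₂ _≤_ (+-suc a a) refl (+-monoʳ-≤ a a<t))) ,
        subst₂ _≤_ (sym (+-suc a t)) refl (s≤s (+-monoʳ-≤ a t≤))))

  meetsPacking-right : ∀ s t → s ≤ a + a → t ≤ a → MeetsPacking right s t
  meetsPacking-right s t s≤ t≤ with <-cmp s a
  ... | tri≈ _ refl _ = suc s , suc (a + a) ,
     inj₁ (refl , s≤s (≤-trans t≤ (m≤m+n a a)) , m≤m+n _ t) ,
     inj₂ (inj₁ (refl , ≤-refl , s≤s (≤-trans s≤ (m≤m+n (a + a) a))))
  ... | tri> _ _ a<s = suc s , suc (a + a) ,
     inj₁ (refl , s≤s (≤-trans t≤ (m≤m+n a a)) , m≤m+n _ t) ,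
     inj₂ (inj₁ (refl , s≤s (<⇒≤ a<s) , s≤s (≤-trans s≤ (m≤m+n (a + a) a))))
  ... | tri< s<a _ _ with <-cmp t a
  ...   | tri< t<a _ _ = suc s , a ,
     inj₁ (refl , t<a , s≤s (≤-trans (n≤1+n b) (≤-trans (m≤m+n a a) (m≤m+n _ t)))) ,
     inj₁ (inj₁ (refl , s≤s z≤n ,
        subst₂ _≤_ refl (sym (+-identityʳ _)) (≤-trans s<a (≤-trans (m≤m+n a a) (n≤1+n _)))))
  ...   | tri≈ _ refl _ = suc a , a + suc a ,
     inj₂ (refl , s≤s s<a , m≤m+n _ s) ,
     inj₂ (inj₁ (+-suc a a , ≤-refl , s≤s (≤-trans (m≤m+n a a) (m≤m+n (a + a) a))))
  ...   | tri> _ _ a<t = ⊥-elim (<⇒≱ a<t t≤)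

  fits⇒meetsPacking : ∀ k s t → Fits a k s t → MeetsPacking k s t
  fits⇒meetsPacking up    s t (s≤ , t≤) = meetsPacking-up s t s≤ t≤
  fits⇒meetsPacking left  s t (s≤ , t≤) = meetsPacking-left s t s≤ t≤
  fits⇒meetsPacking down  s t (s≤ , t≤) = meetsPacking-down s t s≤ t≤
  fits⇒meetsPacking right s t (s≤ , t≤) = meetsPacking-right s t s≤ t≤

  1+2a≰1+a : suc (a + a) ≤ suc a → ⊥
  1+2a≰1+a p = <⇒≱ (s≤s (m≤n+m a b)) (≤-pred p)

  2a+1≰1+a+0 : a + suc a ≤ suc a + 0 → ⊥
  2a+1≰1+a+0 =
    <⇒≱ (subst₂ _≤_ refl (sym (+-suc a a)) (s≤s (s≤s (subst₂ _≤_ (sym (+-identityʳ a)) refl (m≤n+m a b)))))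

  3a+1≰2a+1 : a + suc (a + a) ≤ suc a + a → ⊥
  3a+1≰2a+1 = <⇒≱ (subst₂ _≤_ refl (sym (+-suc a (a + a))) (s≤s (s≤s (m≤n+m (a + a) b))))

  avoidable-up-middle : ∀ s → Avoidable a up s a
  avoidable-up-middle s = down , otherThan s , a + a , (otherThan≤1+ s b , ≤-refl) , apart
    where
    apart : ∀ X Y → Covers a down (otherThan s) (a + a) X Y → Covers a up s a X Y → ⊥
    apart X Y c′ (inj₁ (refl , _ , _)) =
      1+2a≰1+a (InBox.t<Y (covers⇒inBox a down (otherThan s) (a + a) X Y c′))
    apart X Y (inj₁ (refl , _ , _)) (inj₂ (refl , _ , Y≤)) = 3a+1≰2a+1 Y≤
    apart X Y (inj₂ (e , _ , _)) (inj₂ (refl , _ , _)) = otherThan≢ s (sym (1+a+s≡a+1+s′⇒s≡s′ a e))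

  avoidable-down-middle : ∀ s → Avoidable a down s a
  avoidable-down-middle s = up , otherThan s , 0 , (otherThan≤1+ s b , z≤n) , apart
    where
    apart : ∀ X Y → Covers a up (otherThan s) 0 X Y → Covers a down s a X Y → ⊥
    apart X Y c′ (inj₁ (refl , _ , _)) =
      2a+1≰1+a+0 (InBox.Y≤ (covers⇒inBox a up (otherThan s) 0 X Y c′))
    apart X Y (inj₁ (refl , _ , _)) (inj₂ (refl , s≤s () , _))
    apart X Y (inj₂ (e , _ , _)) (inj₂ (refl , _ , _)) = otherThan≢ s (1+a+s≡a+1+s′⇒s≡s′ a (sym e))

  avoidable-left-middle : ∀ t → Avoidable a left a t
  avoidable-left-middle t = right , 0 , otherThan t , (z≤n , otherThan≤1+ t b) , apart
    where
    apart : ∀ X Y → Covers a right 0 (otherThan t) X Y → Covers a left a t X Y → ⊥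
    apart X Y c′ (inj₁ (refl , _ , _)) =
      2a+1≰1+a+0 (InBox.X≤ (covers⇒inBox a right 0 (otherThan t) X Y c′))
    apart X Y (inj₁ (refl , _ , _)) (inj₂ (refl , s≤s () , _))
    apart X Y (inj₂ (e , _ , _)) (inj₂ (refl , _ , _)) = otherThan≢ t (sym (1+a+s≡a+1+s′⇒s≡s′ a e))

  avoidable-right-middle : ∀ t → Avoidable a right a t
  avoidable-right-middle t = left , a + a , otherThan t , (≤-refl , otherThan≤1+ t b) , apart
    where
    apart : ∀ X Y → Covers a left (a + a) (otherThan t) X Y → Covers a right a t X Y → ⊥
    apart X Y c′ (inj₁ (refl , _ , _)) =
      1+2a≰1+a (InBox.s<X (covers⇒inBox a left (a + a) (otherThan t) X Y c′))
    apart X Y (inj₁ (refl , _ , _)) (inj₂ (refl , _ , X≤)) = 3a+1≰2a+1 X≤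
    apart X Y (inj₂ (e , _ , _)) (inj₂ (refl , _ , _)) = otherThan≢ t (1+a+s≡a+1+s′⇒s≡s′ a (sym e))

  avoidable : ∀ k s t → Avoidable a k s t
  avoidable up s t with <-cmp t a
  ... | tri< t<a _ _ = avoidable-below a up s t refl t<a
  ... | tri≈ _ refl _ = avoidable-up-middle s
  ... | tri> _ _ a<t = avoidable-above a up s t a<t
  avoidable down s t with <-cmp t a
  ... | tri< t<a _ _ = avoidable-below a down s t refl t<a
  ... | tri≈ _ refl _ = avoidable-down-middle s
  ... | tri> _ _ a<t = avoidable-above a down s t a<t
  avoidable left s t with <-cmp s a
  ... | tri< s<a _ _ = avoidable-leftOf a left s t refl s<a
  ... | tri≈ _ refl _ = avoidable-left-middle t
  ... | tri> _ _ a<s = avoidable-rightOf a left s t a<s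
  avoidable right s t with <-cmp s a
  ... | tri< s<a _ _ = avoidable-leftOf a right s t refl s<a
  ... | tri≈ _ refl _ = avoidable-right-middle t
  ... | tri> _ _ a<s = avoidable-rightOf a right s t a<s

  lowerT-upperT-disjoint : Disjoint lowerT upperT
  lowerT-upperT-disjoint = placements-disjoint a up 0 b up a (a + a)
    λ X Y c c′ → separated (InBox.Y≤ (covers⇒inBox a up 0 b X Y c))
                             (InBox.t<Y (covers⇒inBox a up a (a + a) X Y c′))
      (s≤s (≤-reflexive (cong suc (sym (+-suc b b)))))

  packing : List Polyomino
  packing = lowerT ∷ upperT ∷ []

  packing-maximal : ∀ Q → FreeEquiv (T a) Q → ¬ ValidArrangement (size (T a)) (Q ∷ packing)
  packing-maximal Q fe ((inQ ∷ _) , ((Q#lower ∷ Q#upper ∷ []) ∷ _))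
    with inBoard-freeEquiv⇒placement Q fe (liesIn-size⇒boardSide a inQ)
  ... | k , s , t , fits , same with fits⇒meetsPacking k s t fits
  ...   | X , Y , c , inj₁ c′ = sharedCell⇒¬disjoint a k s t up 0 b X Y same c c′ Q#lower
  ...   | X , Y , c , inj₂ c′ =
    sharedCell⇒¬disjoint a k s t up a (a + a) X Y same c c′ Q#upper

  packing-isFreePacking : IsFreePacking (T a) packing
  packing-isFreePacking =
    (placement-freeEquiv a up 0 b ∷ placement-freeEquiv a up a (a + a) ∷ []) ,
    ((fits⇒liesIn-size a up 0 b (z≤n , ≤-trans (n≤1+n b) (m≤m+n a a)) ∷
      fits⇒liesIn-size a up a (a + a) (≤-refl , ≤-refl) ∷ []) ,
     ((lowerT-upperT-disjoint ∷ []) ∷ [] ∷ [])) ,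
    packing-maximal

  freePacking-length≥2 : ∀ A → IsFreePacking (T a) A → 2 ≤ length A
  freePacking-length≥2 [] (_ , _ , maximal) =
    ⊥-elim (maximal (placement a up 0 0) (placement-freeEquiv a up 0 0)
      ((fits⇒liesIn-size a up 0 0 (z≤n , z≤n) ∷ []) , ([] ∷ [])))
  freePacking-length≥2 (P ∷ []) ((fe ∷ []) , ((inP ∷ []) , _) , maximal)
    with inBoard-freeEquiv⇒placement P fe (liesIn-size⇒boardSide a inP)
  ... | k , s , t , _ , same with avoidable k s t
  ...   | k′ , s′ , t′ , fits′ , apart =
    ⊥-elim (maximal (placement a k′ s′ t′) (placement-freeEquiv a k′ s′ t′)
      ((fits⇒liesIn-size a k′ s′ t′ fits′ ∷ inP ∷ []) ,
       ((disjoint-sameCells same (placements-disjoint a k′ s′ t′ k s t apart) ∷ []) ∷ [] ∷ [])))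
  freePacking-length≥2 (_ ∷ _ ∷ _) _ = s≤s (s≤s z≤n)

theorem3p16 : (a : ℕ) → 1 ≤ a → CpFreeIs (T a) 2
theorem3p16 zero ()
theorem3p16 (suc b) _ = (packing b , packing-isFreePacking b , refl) , freePacking-length≥2 b
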